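{- Let $\omega$ be a permutation of $[n]$, and let $\mathcal{C}^0=\mathcal{C}^0_\omega$ be the collection consisting of $\emptyset$ together with all sets $I^k_\omega\cap[j..n]$ for $1\le k\le n$ and $1\le j\le\omega^{ -1}(k)$. Let $X\subset[n]$ with $X\notin\mathcal{C}^0$. Then the following are equivalent: (i) $X$ is weakly separated from every member of $\mathcal{C}^0$; (ii) $X$ is an $\omega$-chamber set.
   Context: $[n]=\{1,\dots,n\}$, $[j..n]=\{j,j+1,\dots,n\}$, and $I^k_\omega=\omega^{ -1}([k])=\{i:\omega(i)\le k\}$ (so $I^0_\omega=\emptyset$). For $A,B\subseteq[n]$ write $A\lessdot B$ if $B-A\neq\emptyset$ and $i<j$ for all $i\in A-B$, $j\in B-A$. Write $A\rhd B$ if both $A-B$ and $B-A$ are nonempty and $B-A$ is a disjoint union $B'\sqcup B''$ of nonempty sets with $b'<a<b''$ for all $b'\in B'$, $a\in A-B$, $b''\in B''$. Sets $A,B$ are weakly separated if $A\lessdot B$, or $B\lessdot A$, or ($A\rhd B$ and $|A|\ge|B|$), or ($B\rhd A$ and $|B|\ge|A|$), or $A=B$. A set $X\subseteq[n]$ is an $\omega$-chamber set if $i\in X$, $j<i$ and $\omega(j)<\omega(i)$ imply $j\in X$. -}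

module Defs where

open import Data.Nat using (ℕ; _≥_)
open import Data.Fin using (Fin; _<_; _≤_)
open import Data.Fin.Subset using (Subset; _∈_; _∉_; ∣_∣; ⊥)
open import Data.Fin.Permutation using (Permutation′; _⟨$⟩ʳ_; _⟨$⟩ˡ_)
open import Data.Vec using (tabulate)
open import Data.Bool using (Bool; _∧_)
open import Data.Product using (Σ; _×_; ∃; ∃-syntax)
open import Data.Sum using (_⊎_)
open import Relation.Nullary using (¬_; does)
open import Relation.Binary.PropositionalEquality using (_≡_)
import Data.Fin as F

-- Convention: [n] = {1,…,n} is represented by Fin n, with element i : Fin n
-- standing for toℕ i + 1.  The order is preserved.  A permutation ω of [n]
-- is a  Permutation′ n ; ω(i) is  ω ⟨$⟩ʳ i  and ω⁻¹(k) is  ω ⟨$⟩ˡ k.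

_∈_−_ : ∀ {n} → Fin n → Subset n → Subset n → Set
i ∈ A − B = (i ∈ A) × (i ∉ B)

NonEmptyDiff : ∀ {n} → Subset n → Subset n → Set
NonEmptyDiff A B = ∃[ i ] (i ∈ A − B)

_⋖_ : ∀ {n} → Subset n → Subset n → Set
A ⋖ B = NonEmptyDiff B A ×
        (∀ i j → i ∈ A − B → j ∈ B − A → i < j)

_▷_ : ∀ {n} → Subset n → Subset n → Set
_▷_ {n} A B =
  NonEmptyDiff A B × NonEmptyDiff B A ×
  Σ (Subset n) λ B′ → Σ (Subset n) λ B″ →
    (∀ x → x ∈ B − A → (x ∈ B′) ⊎ (x ∈ B″)) ×
    (∀ x → x ∈ B′ → x ∈ B − A) ×
    (∀ x → x ∈ B″ → x ∈ B − A) ×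
    (∀ x → x ∈ B′ → x ∈ B″ → Data.Empty.⊥) ×
    (∃[ x ] x ∈ B′) × (∃[ x ] x ∈ B″) ×
    (∀ b′ a b″ → b′ ∈ B′ → a ∈ A − B → b″ ∈ B″ → (b′ < a) × (a < b″))
  where import Data.Empty

WeaklySeparated : ∀ {n} → Subset n → Subset n → Set
WeaklySeparated A B =
  (A ⋖ B) ⊎ (B ⋖ A) ⊎ ((A ▷ B) × ∣ A ∣ ≥ ∣ B ∣) ⊎ ((B ▷ A) × ∣ B ∣ ≥ ∣ A ∣) ⊎ (A ≡ B)

-- I^k_ω ∩ [j..n], for k ∈ [n] (here k : Fin n) and j ∈ [n] (j : Fin n):
-- the set { i : ω(i) ≤ k and j ≤ i }.
IJ : ∀ {n} → Permutation′ n → Fin n → Fin n → Subset n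
IJ ω k j = tabulate λ i → does ((ω ⟨$⟩ʳ i) F.≤? k) ∧ does (j F.≤? i)

InC0 : ∀ {n} → Permutation′ n → Subset n → Set
InC0 ω X = (X ≡ ⊥) ⊎ (∃[ k ] ∃[ j ] ((j ≤ (ω ⟨$⟩ˡ k)) × (X ≡ IJ ω k j)))

IsChamber : ∀ {n} → Permutation′ n → Subset n → Set
IsChamber ω X = ∀ i j → i ∈ X → j < i → (ω ⟨$⟩ʳ j) < (ω ⟨$⟩ʳ i) → j ∈ X

module Submission where

-- Call a pair b < a with b ∉ X, a ∈ X and ω(b) < ω(a) a violation; X is a chamber set
-- iff it has no violation.
-- (ii ⇒ i)  Without violations, for each Y = I^k ∩ [j..n] every element of X − Y lies
--   before every element of Y − X, so X ⋖ Y or Y ⋖ X.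
-- (i ⇒ ii)  The key obstruction: if some b ∈ B − A lies strictly between two elements of
--   A − B, the sets A and B can only be weakly separated through B ▷ A with |B| ≥ |A|.
--   Let t = min X and let p ∈ X maximise ω, k = ω(p).
--   * Take the violation (g, x) with g ≥ t and g largest.  For Y = I^{ω(g)} ∩ [g..n],
--     g ∈ Y − X lies between t, x ∈ X − Y; either Y − X = {g}, whence |Y| < |X|, or a
--     second element of Y − X lies beyond x, which is incompatible with Y ▷ X.
--     So every violation starts below t.
--   * Then X ⊊ I^k ∩ [t..n] (strict since X ∉ 𝒞⁰), which yields g ∉ X with p < g and
--     ω(g) < k.  For Y = I^{k-1}, the set X − Y = {p} lies between b, g ∈ Y − X for any
--     violation (b, a), and |X| < |Y|; so no violation exists.

open import Defs
open import Data.Nat using (ℕ)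
open import Data.Fin.Subset using (Subset)
open import Data.Fin.Permutation using (Permutation′)
open import Relation.Nullary using (¬_)
open import Function.Bundles using (_⇔_)

open import Data.Nat as ℕ using (suc; _+_; z≤n; s≤s)
import Data.Nat.Properties as ℕP
open import Data.Fin as F using (Fin; toℕ)
import Data.Fin.Properties as FP
open import Data.Fin.Induction using (<-wellFounded; >-wellFounded)
open import Data.Fin.Subset using (_∈_; _∉_; ∣_∣; _─_; ⁅_⁆; inside; outside; _⊆_)
open import Data.Fin.Subset.Properties
  using (_∈?_; ∉⊥; ⊆-antisym; p⊆q⇒∣p∣≤∣q∣; ∣⁅x⁆∣≡1; x∈⁅x⁆; p─q⊆p;
         x∈p∧x∉q⇒x∈p─q; x∈p∧x≢y⇒x∈p-y; x∈p⇒∣p-x∣<∣p∣)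
open import Data.Fin.Permutation using (_⟨$⟩ʳ_; _⟨$⟩ˡ_; inverseˡ)
open import Data.Vec using ([]; _∷_; here; there; tabulate)
open import Data.Vec.Properties using (lookup∘tabulate; []=⇒lookup; lookup⇒[]=)
open import Data.Bool using (true)
open import Data.Product using (_×_; _,_; proj₁; proj₂; ∃-syntax)
open import Data.Sum using (inj₁; inj₂)
open import Data.Empty using (⊥-elim) renaming (⊥ to Empty)
open import Relation.Nullary using (Dec; yes; no; does; ¬?; contradiction)
open import Relation.Nullary.Decidable using (_×-dec_; dec-true)
open import Level using (0ℓ)
open import Relation.Unary using (Pred; Decidable)
open import Relation.Binary using (Rel)
open import Relation.Binary.Definitions using (Tri; tri<; tri≈; tri>)
import Relation.Binary.Construct.On as On
open import Induction.WellFounded using (WellFounded; Acc; acc)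
open import Relation.Binary.PropositionalEquality
open import Function.Bundles using (mk⇔)
open import Function using (_∘_)

does-true : ∀ {A : Set} (a? : Dec A) → does a? ≡ true → A
does-true (yes a) _ = a

module _ {n : ℕ} {P : Pred (Fin n) 0ℓ} (P? : Decidable P) where

  ∈tabulate⁻ : ∀ {i} → i ∈ tabulate (λ x → does (P? x)) → P i
  ∈tabulate⁻ {i} h =
    does-true (P? i) (trans (sym (lookup∘tabulate (λ x → does (P? x)) i)) ([]=⇒lookup h))

  ∈tabulate⁺ : ∀ {i} → P i → i ∈ tabulate (λ x → does (P? x))
  ∈tabulate⁺ {i} pi =
    lookup⇒[]= i _ (trans (lookup∘tabulate (λ x → does (P? x)) i) (dec-true (P? i) pi))

difference? : ∀ {n} (p q : Subset n) → Dec (∃[ x ] x ∈ p − q)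
difference? p q = FP.any? (λ x → (x ∈? p) ×-dec ¬? (x ∈? q))

noDifference⇒⊆ : ∀ {n} {p q : Subset n} → ¬ (∃[ x ] x ∈ q − p) → q ⊆ p
noDifference⇒⊆ {p = p} none {x} x∈q with x ∈? p
... | yes x∈p = x∈p
... | no x∉p = contradiction (x , x∈q , x∉p) none

x∈p─q⇒x∉q : ∀ {n} {x : Fin n} (p q : Subset n) → x ∈ p ─ q → x ∉ q
x∈p─q⇒x∉q (_ ∷ p) (outside ∷ q) here ()
x∈p─q⇒x∉q (_ ∷ p) (_ ∷ q) (there h) (there h′) = x∈p─q⇒x∉q p q h h′

-- Inclusion–exclusion: both sides count p ∪ q.
∣p∣+∣q─p∣≡∣q∣+∣p─q∣ : ∀ {n} (p q : Subset n) → ∣ p ∣ + ∣ q ─ p ∣ ≡ ∣ q ∣ + ∣ p ─ q ∣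
∣p∣+∣q─p∣≡∣q∣+∣p─q∣ [] [] = refl
∣p∣+∣q─p∣≡∣q∣+∣p─q∣ (inside ∷ p) (inside ∷ q) = cong suc (∣p∣+∣q─p∣≡∣q∣+∣p─q∣ p q)
∣p∣+∣q─p∣≡∣q∣+∣p─q∣ (outside ∷ p) (outside ∷ q) = ∣p∣+∣q─p∣≡∣q∣+∣p─q∣ p q
∣p∣+∣q─p∣≡∣q∣+∣p─q∣ (inside ∷ p) (outside ∷ q) =
  trans (cong suc (∣p∣+∣q─p∣≡∣q∣+∣p─q∣ p q)) (sym (ℕP.+-suc _ _))
∣p∣+∣q─p∣≡∣q∣+∣p─q∣ (outside ∷ p) (inside ∷ q) =
  trans (ℕP.+-suc _ _) (cong suc (∣p∣+∣q─p∣≡∣q∣+∣p─q∣ p q))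

∣p∣<∣q∣ : ∀ {n} (p q : Subset n) (c u v : Fin n) → (∀ i → i ∈ p − q → i ≡ c) →
          u ∈ q − p → v ∈ q − p → u ≢ v → ∣ p ∣ ℕ.< ∣ q ∣
∣p∣<∣q∣ p q c u v only (u∈q , u∉p) (v∈q , v∉p) u≢v = ℕP.+-cancelʳ-< _ _ _ (begin-strict
    ∣ p ∣ + 1       <⟨ ℕP.+-monoʳ-< ∣ p ∣ ∣q─p∣≥2 ⟩
    ∣ p ∣ + ∣ q ─ p ∣ ≡⟨ ∣p∣+∣q─p∣≡∣q∣+∣p─q∣ p q ⟩
    ∣ q ∣ + ∣ p ─ q ∣ ≤⟨ ℕP.+-monoʳ-≤ ∣ q ∣ ∣p─q∣≤1 ⟩
    ∣ q ∣ + 1       ∎)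
  where
  open ℕP.≤-Reasoning
  ∣p─q∣≤1 : ∣ p ─ q ∣ ℕ.≤ 1
  ∣p─q∣≤1 = subst (∣ p ─ q ∣ ℕ.≤_) (∣⁅x⁆∣≡1 c) (p⊆q⇒∣p∣≤∣q∣ λ {i} i∈p─q →
    subst (_∈ ⁅ c ⁆) (sym (only i (p─q⊆p p q i∈p─q , x∈p─q⇒x∉q p q i∈p─q))) (x∈⁅x⁆ c))
  -- removing u from q ─ p leaves v, so the difference has at least two elements
  ∣q─p∣≥2 : 1 ℕ.< ∣ q ─ p ∣
  ∣q─p∣≥2 = ℕP.<-≤-trans
    (s≤s (ℕP.≤-<-trans z≤n (x∈p⇒∣p-x∣<∣p∣ (x∈p∧x≢y⇒x∈p-y (x∈p∧x∉q⇒x∈p─q v∈q v∉p) (u≢v ∘ sym)))))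
    (x∈p⇒∣p-x∣<∣p∣ (x∈p∧x∉q⇒x∈p─q u∈q u∉p))

minimal : ∀ {n r} {P : Pred (Fin n) 0ℓ} {_≺_ : Rel (Fin n) r} → Decidable P →
          (∀ x y → Dec (x ≺ y)) → WellFounded _≺_ →
          ∀ {x} → P x → ∃[ m ] (P m × (∀ y → P y → ¬ (y ≺ m)))
minimal {P = P} {_≺_} P? _≺?_ wf {x} px = descend x (wf x) px
  where
  descend : ∀ x → Acc _≺_ x → P x → ∃[ m ] (P m × (∀ y → P y → ¬ (y ≺ m)))
  descend x (acc smaller) px with FP.any? (λ y → (y ≺? x) ×-dec P? y)
  ... | yes (y , y≺x , py) = descend y (smaller y≺x) py
  ... | no none = x , px , λ y py y≺x → none (y , y≺x , py)

least : ∀ {n} {P : Pred (Fin n) 0ℓ} → Decidable P →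
        ∀ {x} → P x → ∃[ m ] (P m × (∀ y → P y → m F.≤ y))
least P? px with minimal P? F._<?_ <-wellFounded px
... | m , pm , min = m , pm , λ y py → ℕP.≮⇒≥ (min y py)

greatestBy : ∀ {n m} {P : Pred (Fin n) 0ℓ} (f : Fin n → Fin m) → Decidable P →
             ∀ {x} → P x → ∃[ g ] (P g × (∀ y → P y → f y F.≤ f g))
greatestBy f P? px with minimal P? (λ x y → f y F.<? f x) (On.wellFounded f >-wellFounded) px
... | g , pg , max = g , pg , λ y py → ℕP.≮⇒≥ (max y py)

bottom : ∀ {n} → Fin n → Fin n
bottom {suc _} _ = F.zero

bottom-≤ : ∀ {n} (i j : Fin n) → bottom i F.≤ j
bottom-≤ {suc _} _ _ = z≤n

pred<self : ∀ {n} {i k : Fin n} → i F.< k → F.pred k F.< k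
pred<self {k = F.suc k} _ = FP.pred< (F.suc k) λ ()

<⇒≤pred : ∀ {n} {i k : Fin n} → i F.< k → i F.≤ F.pred k
<⇒≤pred {k = F.suc k} i<k = subst (toℕ _ ℕ.≤_) (sym (FP.toℕ-inject₁ k)) (ℕ.s≤s⁻¹ i<k)

module _ {n : ℕ} {A B : Subset n} where

  ws-sym : WeaklySeparated A B → WeaklySeparated B A
  ws-sym (inj₁ A⋖B) = inj₂ (inj₁ A⋖B)
  ws-sym (inj₂ (inj₁ B⋖A)) = inj₁ B⋖A
  ws-sym (inj₂ (inj₂ (inj₁ A▷B))) = inj₂ (inj₂ (inj₂ (inj₁ A▷B)))
  ws-sym (inj₂ (inj₂ (inj₂ (inj₁ B▷A)))) = inj₂ (inj₂ (inj₁ B▷A))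
  ws-sym (inj₂ (inj₂ (inj₂ (inj₂ A≡B)))) = inj₂ (inj₂ (inj₂ (inj₂ (sym A≡B))))

  ordered⇒ws : (∀ a b → a ∈ A − B → b ∈ B − A → a F.< b) → A ≢ B → WeaklySeparated A B
  ordered⇒ws before A≢B with difference? B A | difference? A B
  ... | yes B−A≠∅ | _ = inj₁ (B−A≠∅ , before)
  ... | no B−A=∅ | yes A−B≠∅ = inj₂ (inj₁ (A−B≠∅ , λ b _ b∈B−A _ → ⊥-elim (B−A=∅ (b , b∈B−A))))
  ... | no B−A=∅ | no A−B=∅ =
    ⊥-elim (A≢B (⊆-antisym (noDifference⇒⊆ A−B=∅) (noDifference⇒⊆ B−A=∅)))

  -- If A ▷ B, no element of B − A lies strictly between two elements of A − B:
  -- each element of B − A lies before all or after all of A − B.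
  ▷⇒noInterleaving : ∀ {a₁ b a₂} → A ▷ B → a₁ ∈ A − B → b ∈ B − A → a₂ ∈ A − B →
                     a₁ F.< b → b F.< a₂ → Empty
  ▷⇒noInterleaving (_ , _ , B′ , B″ , split , _ , _ , _ , (b′ , b′∈B′) , (b″ , b″∈B″) , around)
                   a₁∈A−B b∈B−A a₂∈A−B a₁<b b<a₂ with split _ b∈B−A
  ... | inj₁ b∈B′ = FP.<-asym a₁<b (proj₁ (around _ _ b″ b∈B′ a₁∈A−B b″∈B″))
  ... | inj₂ b∈B″ = FP.<-asym b<a₂ (proj₂ (around b′ _ _ b′∈B′ a₂∈A−B b∈B″))

  interleaved⇒¬ws : ∀ {a₁ b a₂} → a₁ ∈ A − B → b ∈ B − A → a₂ ∈ A − B →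
                    a₁ F.< b → b F.< a₂ → ¬ ((B ▷ A) × ∣ B ∣ ℕ.≥ ∣ A ∣) →
                    ¬ WeaklySeparated A B
  interleaved⇒¬ws a₁∈ b∈ a₂∈ a₁<b b<a₂ no-B▷A (inj₁ (_ , before)) =
    FP.<-asym b<a₂ (before _ _ a₂∈ b∈)
  interleaved⇒¬ws a₁∈ b∈ a₂∈ a₁<b b<a₂ no-B▷A (inj₂ (inj₁ (_ , before))) =
    FP.<-asym a₁<b (before _ _ b∈ a₁∈)
  interleaved⇒¬ws a₁∈ b∈ a₂∈ a₁<b b<a₂ no-B▷A (inj₂ (inj₂ (inj₁ (A▷B , _)))) =
    ▷⇒noInterleaving A▷B a₁∈ b∈ a₂∈ a₁<b b<a₂
  interleaved⇒¬ws a₁∈ b∈ a₂∈ a₁<b b<a₂ no-B▷A (inj₂ (inj₂ (inj₂ (inj₁ B▷A)))) = no-B▷A B▷A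
  interleaved⇒¬ws a₁∈ (b∈B , b∉A) a₂∈ a₁<b b<a₂ no-B▷A (inj₂ (inj₂ (inj₂ (inj₂ refl)))) =
    b∉A b∈B

module Chambers {n : ℕ} (ω : Permutation′ n) where

  ω⟨_⟩ : Fin n → Fin n
  ω⟨ i ⟩ = ω ⟨$⟩ʳ i

  ω-injective : ∀ {i j} → ω⟨ i ⟩ ≡ ω⟨ j ⟩ → i ≡ j
  ω-injective e = trans (sym (inverseˡ ω)) (trans (cong (ω ⟨$⟩ˡ_) e) (inverseˡ ω))

  ∈IJ⁻ : ∀ k j {i} → i ∈ IJ ω k j → (ω⟨ i ⟩ F.≤ k) × (j F.≤ i)
  ∈IJ⁻ k j = ∈tabulate⁻ (λ i → (ω⟨ i ⟩ F.≤? k) ×-dec (j F.≤? i))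

  ∈IJ⁺ : ∀ k j {i} → ω⟨ i ⟩ F.≤ k → j F.≤ i → i ∈ IJ ω k j
  ∈IJ⁺ k j ωi≤k j≤i = ∈tabulate⁺ (λ i → (ω⟨ i ⟩ F.≤? k) ×-dec (j F.≤? i)) (ωi≤k , j≤i)

  IJ∈C0 : ∀ {k j} → j F.≤ (ω ⟨$⟩ˡ k) → InC0 ω (IJ ω k j)
  IJ∈C0 {k} {j} j≤ω⁻¹k = inj₂ (k , j , j≤ω⁻¹k , refl)

  -- (ii ⇒ i)  In a chamber set X, every element of X − Y precedes every element of Y − X
  -- for Y = I^k ∩ [j..n]: an element y of Y − X before some x ∈ X − Y would force
  -- ω(x) > k ≥ ω(y) and hence y ∈ X.
  chamber⇒ordered : ∀ {X} → IsChamber ω X → ∀ k j x y →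
                    x ∈ X − IJ ω k j → y ∈ IJ ω k j − X → x F.< y
  chamber⇒ordered {X} chamber k j x y (x∈X , x∉Y) (y∈Y , y∉X)
    with ∈IJ⁻ k j y∈Y | FP.<-cmp x y
  ... | _ | tri< x<y _ _ = x<y
  ... | _ | tri≈ _ refl _ = contradiction x∈X y∉X
  ... | ωy≤k , j≤y | tri> _ _ y<x with ω⟨ x ⟩ F.≤? k
  ...   | yes ωx≤k = contradiction (∈IJ⁺ k j ωx≤k (FP.≤-trans j≤y (ℕP.<⇒≤ y<x))) x∉Y
  ...   | no ωx≰k = contradiction (chamber x y x∈X y<x (ℕP.≤-<-trans ωy≤k (ℕP.≰⇒> ωx≰k))) y∉X

  chamber⇒separated : ∀ {X} → ¬ InC0 ω X → IsChamber ω X →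
                      ∀ Y → InC0 ω Y → WeaklySeparated X Y
  chamber⇒separated X∉C0 chamber _ (inj₁ refl) =
    ordered⇒ws (λ _ _ _ b∈⊥−X → contradiction (proj₁ b∈⊥−X) ∉⊥) (X∉C0 ∘ inj₁)
  chamber⇒separated X∉C0 chamber _ (inj₂ (k , j , j≤ω⁻¹k , refl)) =
    ordered⇒ws (chamber⇒ordered chamber k j)
               (λ X≡Y → X∉C0 (subst (InC0 ω) (sym X≡Y) (IJ∈C0 j≤ω⁻¹k)))

  Violation : Subset n → Fin n → Fin n → Set
  Violation X b a = b ∉ X × a ∈ X × b F.< a × ω⟨ b ⟩ F.< ω⟨ a ⟩

  violation? : ∀ X b → Dec (∃[ a ] Violation X b a)
  violation? X b = FP.any? λ a →
    ¬? (b ∈? X) ×-dec (a ∈? X) ×-dec (b F.<? a) ×-dec (ω⟨ b ⟩ F.<? ω⟨ a ⟩)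

  module Separated (X : Subset n) (X∉C0 : ¬ InC0 ω X)
                   (separated : ∀ Y → InC0 ω Y → WeaklySeparated X Y) where

    -- A violation (g, x) with g above an element t of X, such that no violation starts
    -- after g, is impossible: for Y = I^{ω(g)} ∩ [g..n], g ∈ Y − X lies between t and x
    -- in X − Y, and Y ▷ X with |Y| ≥ |X| fails too.
    noTopViolation : ∀ {t g x} → t ∈ X → t F.≤ g → Violation X g x →
                     (∀ {g′ x′} → g F.< g′ → ¬ Violation X g′ x′) → Empty
    noTopViolation {t} {g} {x} t∈X t≤g (g∉X , x∈X , g<x , ωg<ωx) lastViolation =
      interleaved⇒¬ws (t∈X , t∉Y) (g∈Y , g∉X) (x∈X , x∉Y) t<g g<x no-Y▷X (separated Y Y∈C0)
      where
      Y : Subset n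
      Y = IJ ω ω⟨ g ⟩ g
      Y∈C0 : InC0 ω Y
      Y∈C0 = IJ∈C0 (FP.≤-reflexive (sym (inverseˡ ω)))
      g∈Y : g ∈ Y
      g∈Y = ∈IJ⁺ ω⟨ g ⟩ g FP.≤-refl FP.≤-refl
      t<g : t F.< g
      t<g = FP.≤∧≢⇒< t≤g λ { refl → g∉X t∈X }
      t∉Y : t ∉ Y
      t∉Y t∈Y = ℕP.<⇒≱ t<g (proj₂ (∈IJ⁻ ω⟨ g ⟩ g t∈Y))
      x∉Y : x ∉ Y
      x∉Y x∈Y = ℕP.<⇒≱ ωg<ωx (proj₁ (∈IJ⁻ ω⟨ g ⟩ g x∈Y))
      -- Either g is the only element of Y − X, so |Y| < |X|, or another one lies after x.
      no-Y▷X : ¬ ((Y ▷ X) × ∣ Y ∣ ℕ.≥ ∣ X ∣)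
      no-Y▷X (Y▷X , ∣Y∣≥∣X∣)
        with FP.any? (λ g′ → ((g′ ∈? Y) ×-dec ¬? (g′ ∈? X)) ×-dec ¬? (g′ F.≟ g))
      ... | no none = ℕP.<⇒≱ (∣p∣<∣q∣ Y X g t x only (t∈X , t∉Y) (x∈X , x∉Y) t≢x) ∣Y∣≥∣X∣
        where
        only : ∀ i → i ∈ Y − X → i ≡ g
        only i i∈Y−X with i F.≟ g
        ... | yes i≡g = i≡g
        ... | no i≢g = contradiction (i , i∈Y−X , i≢g) none
        t≢x : t ≢ x
        t≢x = FP.<⇒≢ (FP.<-trans t<g g<x)
      ... | yes (g′ , (g′∈Y , g′∉X) , g′≢g) with ∈IJ⁻ ω⟨ g ⟩ g g′∈Y | FP.<-cmp g′ x
      ...   | ωg′≤ωg , g≤g′ | tri< g′<x _ _ =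
        lastViolation g<g′ (g′∉X , x∈X , g′<x , FP.<-trans ωg′<ωg ωg<ωx)
        where
        g<g′ : g F.< g′
        g<g′ = FP.≤∧≢⇒< g≤g′ (g′≢g ∘ sym)
        ωg′<ωg : ω⟨ g′ ⟩ F.< ω⟨ g ⟩
        ωg′<ωg = FP.≤∧≢⇒< ωg′≤ωg (g′≢g ∘ ω-injective)
      ...   | _ | tri≈ _ refl _ = g′∉X x∈X
      ...   | _ | tri> _ _ x<g′ =
        ▷⇒noInterleaving Y▷X (g∈Y , g∉X) (x∈X , x∉Y) (g′∈Y , g′∉X) g<x x<g′

    violation⇒before : ∀ {b a t} → Violation X b a → t ∈ X → b F.< t
    violation⇒before {b} {a} {t} v t∈X with t F.≤? b
    ... | no t≰b = ℕP.≰⇒> t≰b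
    ... | yes t≤b with greatestBy (λ g → g) (λ g → (t F.≤? g) ×-dec violation? X g) (t≤b , a , v)
    ...   | g , (t≤g , x , vg) , last =
      ⊥-elim (noTopViolation t∈X t≤g vg λ g<g′ vg′ →
        ℕP.<⇒≱ g<g′ (last _ (FP.≤-trans t≤g (ℕP.<⇒≤ g<g′) , _ , vg′)))

    -- As X ≠ I^{ω(p)} ∩ [t..n] ⊇ X, some g ∉ X has t ≤ g and ω(g) < ω(p);
    -- g cannot precede p, for (g, p) would be a violation.
    gapAfterTop : ∀ {t p} → (∀ y → y ∈ X → t F.≤ y) → p ∈ X →
                  (∀ y → y ∈ X → ω⟨ y ⟩ F.≤ ω⟨ p ⟩) →
                  (∀ {g x} → Violation X g x → g F.< t) →
                  ∃[ g ] (g ∉ X × p F.< g × ω⟨ g ⟩ F.< ω⟨ p ⟩)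
    gapAfterTop {t} {p} t≤ p∈X ω≤ωp before with difference? (IJ ω ω⟨ p ⟩ t) X
    ... | no none = ⊥-elim (X∉C0 (subst (InC0 ω) (⊆-antisym Z⊆X X⊆Z) (IJ∈C0 t≤ω⁻¹ωp)))
      where
      t≤ω⁻¹ωp : t F.≤ ω ⟨$⟩ˡ ω⟨ p ⟩
      t≤ω⁻¹ωp = subst (t F.≤_) (sym (inverseˡ ω)) (t≤ p p∈X)
      X⊆Z : X ⊆ IJ ω ω⟨ p ⟩ t
      X⊆Z {x} x∈X = ∈IJ⁺ ω⟨ p ⟩ t (ω≤ωp x x∈X) (t≤ x x∈X)
      Z⊆X : IJ ω ω⟨ p ⟩ t ⊆ X
      Z⊆X = noDifference⇒⊆ none
    ... | yes (g , g∈Z , g∉X) with ∈IJ⁻ ω⟨ p ⟩ t g∈Z | FP.<-cmp p g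
    ...   | ωg≤ωp , t≤g | cmp = g , g∉X , p<g cmp , ωg<ωp
      where
      ωg<ωp : ω⟨ g ⟩ F.< ω⟨ p ⟩
      ωg<ωp = FP.≤∧≢⇒< ωg≤ωp λ e → g∉X (subst (_∈ X) (sym (ω-injective e)) p∈X)
      p<g : Tri (p F.< g) (p ≡ g) (g F.< p) → p F.< g
      p<g (tri< p<g _ _) = p<g
      p<g (tri≈ _ refl _) = contradiction p∈X g∉X
      p<g (tri> _ _ g<p) = contradiction t≤g (ℕP.<⇒≱ (before (g∉X , p∈X , g<p , ωg<ωp)))

    -- Under the same assumptions no violation (b, a) exists: for Y = I^{ω(p)-1}, the set
    -- X − Y = {p} lies between b and g in Y − X, and |X| < |Y|.
    noLowViolation : ∀ {t p b a} → (∀ y → y ∈ X → t F.≤ y) → p ∈ X →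
                     (∀ y → y ∈ X → ω⟨ y ⟩ F.≤ ω⟨ p ⟩) →
                     (∀ {g x} → Violation X g x → g F.< t) → ¬ Violation X b a
    noLowViolation {_} {p} {b} {a} t≤ p∈X ω≤ωp before v@(b∉X , a∈X , _ , ωb<ωa)
      with gapAfterTop t≤ p∈X ω≤ωp before
    ... | g , g∉X , p<g , ωg<ωp = ¬ws-X-Y (separated Y (IJ∈C0 (bottom-≤ p _)))
      where
      Y : Subset n
      Y = IJ ω (F.pred ω⟨ p ⟩) (bottom p)
      below-ωp⇒∈Y : ∀ {i} → ω⟨ i ⟩ F.< ω⟨ p ⟩ → i ∈ Y
      below-ωp⇒∈Y {i} lt = ∈IJ⁺ (F.pred ω⟨ p ⟩) (bottom p) (<⇒≤pred lt) (bottom-≤ p i)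
      ωb<ωp : ω⟨ b ⟩ F.< ω⟨ p ⟩
      ωb<ωp = ℕP.<-≤-trans ωb<ωa (ω≤ωp a a∈X)
      p∉Y : p ∉ Y
      p∉Y p∈Y = ℕP.<⇒≱ (pred<self ωb<ωp) (proj₁ (∈IJ⁻ (F.pred ω⟨ p ⟩) (bottom p) p∈Y))
      only : ∀ i → i ∈ X − Y → i ≡ p
      only i (i∈X , i∉Y) =
        ω-injective (FP.≤-antisym (ω≤ωp i i∈X) (ℕP.≮⇒≥ (i∉Y ∘ below-ωp⇒∈Y)))
      b<p : b F.< p
      b<p = ℕP.<-≤-trans (before v) (t≤ p p∈X)
      no-X▷Y : ¬ ((X ▷ Y) × ∣ X ∣ ℕ.≥ ∣ Y ∣)
      no-X▷Y (_ , ∣X∣≥∣Y∣) = ℕP.<⇒≱ (∣p∣<∣q∣ X Y p b g only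
        (below-ωp⇒∈Y ωb<ωp , b∉X) (below-ωp⇒∈Y ωg<ωp , g∉X) (FP.<⇒≢ (FP.<-trans b<p p<g))) ∣X∣≥∣Y∣
      ¬ws-X-Y : ¬ WeaklySeparated X Y
      ¬ws-X-Y = interleaved⇒¬ws (below-ωp⇒∈Y ωb<ωp , b∉X) (p∈X , p∉Y)
                                (below-ωp⇒∈Y ωg<ωp , g∉X) b<p p<g no-X▷Y ∘ ws-sym

    noViolation : ∀ {b a} → ¬ Violation X b a
    noViolation v@(_ , a∈X , _)
      with least (_∈? X) a∈X | greatestBy ω⟨_⟩ (_∈? X) a∈X
    ... | t , t∈X , t≤ | p , p∈X , ω≤ωp =
      noLowViolation t≤ p∈X ω≤ωp (λ v′ → violation⇒before v′ t∈X) v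

  separated⇒chamber : ∀ {X} → ¬ InC0 ω X → (∀ Y → InC0 ω Y → WeaklySeparated X Y) →
                      IsChamber ω X
  separated⇒chamber {X} X∉C0 separated a b a∈X b<a ωb<ωa with b ∈? X
  ... | yes b∈X = b∈X
  ... | no b∉X = contradiction (b∉X , a∈X , b<a , ωb<ωa) (Separated.noViolation X X∉C0 separated)

theorem2p1 : (n : ℕ) (ω : Permutation′ n) (X : Subset n) →
    ¬ InC0 ω X →
    ((∀ Y → InC0 ω Y → WeaklySeparated X Y) ⇔ IsChamber ω X)
theorem2p1 n ω X X∉C0 = mk⇔ (separated⇒chamber X∉C0) (chamber⇒separated X∉C0)
  where open Chambers ω
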